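{- Let $a$ be a nonzero integer. For a positive integer $n$, we have $B_a(n)=n$ if and only if $n=4$.
   Context: For a positive integer $n$ with prime factorization $n=p_1^{r_1}\cdots p_k^{r_k}$, let $B(n)=\sum_{i=1}^k r_ip_i$ (so $B(1)=0$, the empty sum). For an integer $a$, define $B_a(n)=n+a$ if $n$ is prime and $B_a(n)=B(n)$ otherwise. -}

module Defs where

open import Data.Nat using (ℕ; zero; suc; _+_; _*_; _^_)
open import Data.Nat.Divisibility using (_∣?_)
open import Data.Nat.Primality using (Prime; prime?)
open import Data.Integer as ℤ using (ℤ; +_)
open import Relation.Nullary using (yes; no)

sum1to : ℕ → (ℕ → ℕ) → ℕ
sum1to zero    f = 0
sum1to (suc m) f = sum1to m f + f (suc m)

-- multiplicity (exponent) of p in n, for n ≥ 1 and p ≥ 2: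
-- r = #{ k ∈ [1, n] : p^k ∣ n }   (note p^k ∣ n forces k < n)
mult : ℕ → ℕ → ℕ
mult p n = sum1to n (λ k → indicator (p ^ k ∣? n))
  where
  indicator : ∀ {A : Set} → Relation.Nullary.Dec A → ℕ
  indicator (yes _) = 1
  indicator (no  _) = 0
  open import Relation.Nullary

-- B(n) = Σ_{p prime, p ≤ n} r_p(n) · p  =  Σ rᵢ pᵢ over the prime factorization
-- (B 1 = 0, empty sum).
B : ℕ → ℕ
B n = sum1to n (λ p → term p)
  where
  term : ℕ → ℕ
  term p with prime? p
  ... | yes _ = mult p n * p
  ... | no  _ = 0

Ba : ℤ → ℕ → ℤ
Ba a n with prime? n
... | yes _ = + n ℤ.+ a
... | no  _ = + B n

{-# OPTIONS --safe #-}

-- Writing a non-prime n ≥ 2 as p · m with p prime and m = q₁ ⋯ qₖ (k ≥ 1), the additivity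
-- B (p · m) = p + B m gives B n = p + q₁ + ⋯ + qₖ ≤ p + m, while n = p · m ≥ p + m since
-- p, m ≥ 2. So B n = n forces p · m = p + m, i.e. p = m = 2. For a prime n, B_a n = n + a ≠ n.

module Submission where

open import Defs
open import Data.Nat using (ℕ; NonZero)
open import Data.Integer using (ℤ; +_)
open import Relation.Binary.PropositionalEquality using (_≡_; _≢_)
open import Data.Product using (_×_)

open import Data.Nat using (zero; suc; _+_; _*_; _^_; _≤_; _<_; _≟_; z≤n; s≤s; >-nonZero; nonTrivial⇒n>1)
open import Data.Nat.Properties
open import Data.Nat.Divisibility
open import Data.Nat.Primality
open import Data.Nat.Primality.Factorisation using (factorise; PrimeFactorisation)
open import Data.Nat.Coprimality using (Coprime; coprime-divisor)
open import Data.Nat.ListAction using (sum; product)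
open import Data.List using ([]; _∷_)
open import Data.List.Relation.Unary.All as All using (All; []; _∷_)
open import Data.Integer.Properties using (+-0-abelianGroup; +-injective)
open import Algebra.Bundles using (AbelianGroup)
open import Algebra.Properties.CommutativeSemigroup +-commutativeSemigroup using (interchange)
open import Algebra.Properties.Group (AbelianGroup.group +-0-abelianGroup) using (identityʳ-unique)
open import Data.Sum using (inj₁; inj₂)
open import Data.Product using (_,_)
open import Function using (_∘_; _⇔_; mk⇔; Equivalence)
open import Relation.Nullary using (Dec; yes; no; ¬_; contradiction)
open import Relation.Binary.PropositionalEquality
  using (refl; sym; trans; cong; cong₂; subst; subst₂; _≗_; module ≡-Reasoning)

private
  variable
    k m n p q M N : ℕ
    A C : Set

𝟙 : Dec A → ℕ
𝟙 (yes _) = 1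
𝟙 (no _)  = 0

𝟙-yes : (a? : Dec A) → A → 𝟙 a? ≡ 1
𝟙-yes (yes _) _ = refl
𝟙-yes (no ¬a) a = contradiction a ¬a

𝟙-no : (a? : Dec A) → ¬ A → 𝟙 a? ≡ 0
𝟙-no (yes a) ¬a = contradiction a ¬a
𝟙-no (no _)  _  = refl

𝟙-cong : (a? : Dec A) (c? : Dec C) → A ⇔ C → 𝟙 a? ≡ 𝟙 c?
𝟙-cong (yes _) (yes _) _   = refl
𝟙-cong (yes a) (no ¬c) a⇔c = contradiction (Equivalence.to a⇔c a) ¬c
𝟙-cong (no ¬a) (yes c) a⇔c = contradiction (Equivalence.from a⇔c c) ¬a
𝟙-cong (no _)  (no _)  _   = refl

sum1to-cong : ∀ N {f g : ℕ → ℕ} → f ≗ g → sum1to N f ≡ sum1to N g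
sum1to-cong zero    f≗g = refl
sum1to-cong (suc N) f≗g = cong₂ _+_ (sum1to-cong N f≗g) (f≗g (suc N))

sum1to-distrib-+ : ∀ N (f g : ℕ → ℕ) → sum1to N (λ k → f k + g k) ≡ sum1to N f + sum1to N g
sum1to-distrib-+ zero    f g = refl
sum1to-distrib-+ (suc N) f g =
  trans (cong (_+ (f (suc N) + g (suc N))) (sum1to-distrib-+ N f g))
        (interchange (sum1to N f) (sum1to N g) (f (suc N)) (g (suc N)))

sum1to-vanishing : ∀ {f : ℕ → ℕ} → M ≤ N → (∀ k → M < k → k ≤ N → f k ≡ 0) → sum1to N f ≡ sum1to M f
sum1to-vanishing {N = zero}  z≤n   _    = refl
sum1to-vanishing {N = suc N} M≤1+N f≡0 with m≤n⇒m<n∨m≡n M≤1+N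
... | inj₂ refl = refl
... | inj₁ (s≤s M≤N) = trans
  (cong₂ _+_ (sum1to-vanishing M≤N (λ k M<k k≤N → f≡0 k M<k (m≤n⇒m≤1+n k≤N))) (f≡0 (suc N) (s≤s M≤N) ≤-refl))
  (+-identityʳ _)

sum1to-shift : ∀ N (f : ℕ → ℕ) → sum1to (suc N) f ≡ f 1 + sum1to N (f ∘ suc)
sum1to-shift zero    f = +-comm 0 (f 1)
sum1to-shift (suc N) f = trans (cong (_+ f (suc (suc N))) (sum1to-shift N f)) (+-assoc (f 1) _ _)

sum1to-single : ∀ (f : ℕ → ℕ) → 0 < p → p ≤ N → (∀ k → k ≢ p → f k ≡ 0) → sum1to N f ≡ f p
sum1to-single {p = suc p} {N} f _ p≤N f≡0 = begin
  sum1to N f              ≡⟨ sum1to-vanishing p≤N (λ k p<k _ → f≡0 k (>⇒≢ p<k)) ⟩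
  sum1to p f + f (suc p)  ≡⟨ cong (_+ f (suc p)) (sum1to-vanishing z≤n (λ k _ k≤p → f≡0 k (<⇒≢ (s≤s k≤p)))) ⟩
  f (suc p)               ∎
  where open ≡-Reasoning

prime>1 : Prime p → 1 < p
prime>1 {p} pp = nonTrivial⇒n>1 p {{prime⇒nonTrivial pp}}

n<m^n : 1 < m → ∀ n → n < m ^ n
n<m^n 1<m zero    = s≤s z≤n
n<m^n {m} 1<m (suc n) = begin-strict
  suc n      ≤⟨ n<m^n 1<m n ⟩
  m ^ n      <⟨ m<m*n (m ^ n) m {{m^n≢0 m n {{>-nonZero (<-trans (s≤s z≤n) 1<m)}}}} 1<m ⟩
  m ^ n * m  ≡⟨ *-comm (m ^ n) m ⟩
  m ^ suc n  ∎
  where open ≤-Reasoning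

^∣⇒< : 1 < m → .{{NonZero n}} → m ^ k ∣ n → k < n
^∣⇒< {k = k} 1<m m^k∣n = <-≤-trans (n<m^n 1<m k) (∣⇒≤ m^k∣n)

prime∣^⇒∣ : Prime p → ∀ k → p ∣ q ^ k → p ∣ q
prime∣^⇒∣ pp zero    p∣1 = contradiction (subst Prime (∣1⇒≡1 p∣1) pp) ¬prime[1]
prime∣^⇒∣ {q = q} pp (suc k) p∣q^1+k with euclidsLemma q (q ^ k) pp p∣q^1+k
... | inj₁ p∣q   = p∣q
... | inj₂ p∣q^k = prime∣^⇒∣ pp k p∣q^k

coprime-^-prime : Prime p → Prime q → q ≢ p → ∀ k → Coprime (q ^ k) p
coprime-^-prime pp pq q≢p k (d∣q^k , d∣p) with prime⇒irreducible pp d∣p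
... | inj₁ d≡1 = d≡1
... | inj₂ refl with prime⇒irreducible pq (prime∣^⇒∣ pp k d∣q^k)
...   | inj₁ p≡1 = contradiction (subst Prime p≡1 pp) ¬prime[1]
...   | inj₂ p≡q = contradiction (sym p≡q) q≢p

primeTerm : ℕ → ℕ → ℕ
primeTerm n q with prime? q
... | yes _ = mult q n * q
... | no _  = 0

-- The summands of mult and B are local to Defs and cannot be named, so the left-hand sides
-- of mult-summand and B-summand are left to unification with their uses above them.

mutual
  mult≡sum1to : ∀ q n → mult q n ≡ sum1to n (λ k → 𝟙 (q ^ k ∣? n))
  mult≡sum1to q n = sum1to-cong n (mult-summand q n)

  B≡sum1to : ∀ n → B n ≡ sum1to n (primeTerm n)
  B≡sum1to n = sum1to-cong n (B-summand n)

  mult-summand : ∀ q n k → _ ≡ 𝟙 (q ^ k ∣? n)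
  mult-summand q n k with q ^ k ∣? n
  ... | yes _ = refl
  ... | no _  = refl

  B-summand : ∀ n q → _ ≡ primeTerm n q
  B-summand n q with prime? q
  ... | yes _ = refl
  ... | no _  = refl

mult-upTo : 1 < q → .{{NonZero n}} → n ≤ N → mult q n ≡ sum1to N (λ k → 𝟙 (q ^ k ∣? n))
mult-upTo {q} {n} 1<q n≤N = trans (mult≡sum1to q n) (sym (sum1to-vanishing n≤N
  (λ k n<k _ → 𝟙-no (q ^ k ∣? n) (λ q^k∣n → <⇒≱ n<k (<⇒≤ (^∣⇒< 1<q q^k∣n))))))

mult-above : n < q → mult q n ≡ 0
mult-above {n} {q} n<q = trans (mult≡sum1to q n) (sum1to-vanishing z≤n q^k∤n)
  where
  q^k∤n : ∀ k → 0 < k → k ≤ n → 𝟙 (q ^ k ∣? n) ≡ 0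
  q^k∤n (suc k) 0<k k≤n = 𝟙-no (q ^ suc k ∣? n)
    (λ q^k∣n → <⇒≱ n<q (∣⇒≤ {{>-nonZero (<-≤-trans 0<k k≤n)}} (∣-trans (m∣m*n (q ^ k)) q^k∣n)))

mult-*-self : Prime p → .{{NonZero n}} → mult p (p * n) ≡ suc (mult p n)
mult-*-self {p} {n} pp = begin
  mult p (p * n)
    ≡⟨ mult-upTo 1<p {{pn≢0}} (n≤1+n (p * n)) ⟩
  sum1to (suc (p * n)) (λ k → 𝟙 (p ^ k ∣? p * n))
    ≡⟨ sum1to-shift (p * n) (λ k → 𝟙 (p ^ k ∣? p * n)) ⟩
  𝟙 (p ^ 1 ∣? p * n) + sum1to (p * n) (λ k → 𝟙 (p * p ^ k ∣? p * n))
    ≡⟨ cong₂ _+_ (𝟙-yes (p ^ 1 ∣? p * n) (*-monoʳ-∣ p (1∣ n))) (sum1to-cong (p * n) cancel-p) ⟩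
  suc (sum1to (p * n) (λ k → 𝟙 (p ^ k ∣? n)))
    ≡⟨ cong suc (mult-upTo 1<p (m≤n*m n p {{p≢0}})) ⟨
  suc (mult p n) ∎
  where
  open ≡-Reasoning
  1<p : 1 < p
  1<p = prime>1 pp
  p≢0 : NonZero p
  p≢0 = prime⇒nonZero pp
  pn≢0 : NonZero (p * n)
  pn≢0 = m*n≢0 p n {{p≢0}}
  cancel-p : ∀ k → 𝟙 (p * p ^ k ∣? p * n) ≡ 𝟙 (p ^ k ∣? n)
  cancel-p k = 𝟙-cong (p * p ^ k ∣? p * n) (p ^ k ∣? n) (mk⇔ (*-cancelˡ-∣ p {{p≢0}}) (*-monoʳ-∣ p))

mult-*-other : Prime p → Prime q → q ≢ p → .{{NonZero n}} → mult q (p * n) ≡ mult q n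
mult-*-other {p} {q} {n} pp pq q≢p = begin
  mult q (p * n)                           ≡⟨ mult≡sum1to q (p * n) ⟩
  sum1to (p * n) (λ k → 𝟙 (q ^ k ∣? p * n)) ≡⟨ sum1to-cong (p * n) drop-p ⟩
  sum1to (p * n) (λ k → 𝟙 (q ^ k ∣? n))     ≡⟨ mult-upTo (prime>1 pq) (m≤n*m n p {{prime⇒nonZero pp}}) ⟨
  mult q n                                 ∎
  where
  open ≡-Reasoning
  drop-p : ∀ k → 𝟙 (q ^ k ∣? p * n) ≡ 𝟙 (q ^ k ∣? n)
  drop-p k = 𝟙-cong (q ^ k ∣? p * n) (q ^ k ∣? n)
    (mk⇔ (coprime-divisor (coprime-^-prime pp pq q≢p k)) (∣n⇒∣m*n p))

primeTerm-above : n < q → primeTerm n q ≡ 0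
primeTerm-above {n} {q} n<q with prime? q
... | yes _ = cong (_* q) (mult-above n<q)
... | no _  = refl

B-upTo : n ≤ N → B n ≡ sum1to N (primeTerm n)
B-upTo {n} n≤N = trans (B≡sum1to n) (sym (sum1to-vanishing n≤N (λ q n<q _ → primeTerm-above n<q)))

primeTerm-*-prime : Prime p → .{{NonZero n}} → ∀ q → primeTerm (p * n) q ≡ primeTerm n q + 𝟙 (q ≟ p) * p
primeTerm-*-prime {p} {n} pp q with prime? q | q ≟ p
... | yes _  | yes refl = begin
  mult p (p * n) * p      ≡⟨ cong (_* p) (mult-*-self pp) ⟩
  p + mult p n * p        ≡⟨ +-comm p (mult p n * p) ⟩
  mult p n * p + p        ≡⟨ cong (_+_ (mult p n * p)) (*-identityˡ p) ⟨
  mult p n * p + 1 * p    ∎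
  where open ≡-Reasoning
... | yes pq | no q≢p   = trans (cong (_* q) (mult-*-other pp pq q≢p)) (sym (+-identityʳ _))
... | no ¬pq | yes refl = contradiction pp ¬pq
... | no _   | no _     = refl

B-*-prime : Prime p → .{{NonZero n}} → B (p * n) ≡ p + B n
B-*-prime {p} {n} pp = begin
  B (p * n)
    ≡⟨ B≡sum1to (p * n) ⟩
  sum1to (p * n) (primeTerm (p * n))
    ≡⟨ sum1to-cong (p * n) (primeTerm-*-prime pp) ⟩
  sum1to (p * n) (λ q → primeTerm n q + 𝟙 (q ≟ p) * p)
    ≡⟨ sum1to-distrib-+ (p * n) (primeTerm n) (λ q → 𝟙 (q ≟ p) * p) ⟩
  sum1to (p * n) (primeTerm n) + sum1to (p * n) (λ q → 𝟙 (q ≟ p) * p)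
    ≡⟨ cong₂ _+_ (sym (B-upTo n≤pn)) (sum1to-single (λ q → 𝟙 (q ≟ p) * p) 0<p p≤pn only-p) ⟩
  B n + 𝟙 (p ≟ p) * p
    ≡⟨ cong (λ c → B n + c * p) (𝟙-yes (p ≟ p) refl) ⟩
  B n + 1 * p
    ≡⟨ cong (_+_ (B n)) (*-identityˡ p) ⟩
  B n + p
    ≡⟨ +-comm (B n) p ⟩
  p + B n ∎
  where
  open ≡-Reasoning
  0<p : 0 < p
  0<p = <-trans (s≤s z≤n) (prime>1 pp)
  n≤pn : n ≤ p * n
  n≤pn = m≤n*m n p {{prime⇒nonZero pp}}
  p≤pn : p ≤ p * n
  p≤pn = m≤m*n p n
  only-p : ∀ q → q ≢ p → 𝟙 (q ≟ p) * p ≡ 0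
  only-p q q≢p = cong (_* p) (𝟙-no (q ≟ p) q≢p)

B-product : ∀ {ps} → All Prime ps → B (product ps) ≡ sum ps
B-product []                  = refl
B-product {p ∷ ps} (pp ∷ pps) =
  trans (B-*-prime pp {{productOfPrimes≢0 pps}}) (cong (_+_ p) (B-product pps))

m+n≤m*n : 1 < m → 1 < n → m + n ≤ m * n
m+n≤m*n {m} {suc n} 1<m (s≤s 0<n) = begin
  m + suc n  ≤⟨ +-monoʳ-≤ m (m<m*n n m {{>-nonZero 0<n}} 1<m) ⟩
  m + n * m  ≡⟨ cong (_+_ m) (*-comm n m) ⟩
  m + m * n  ≡⟨ *-suc m n ⟨
  m * suc n  ∎
  where open ≤-Reasoning

*≤+⇒≤ : 1 < m → m * n ≤ m + n → n ≤ m
*≤+⇒≤ {m} {n} 1<m mn≤m+n = +-cancelʳ-≤ n n m (begin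
  n + n      ≡⟨ cong (_+_ n) (+-identityʳ n) ⟨
  2 * n      ≤⟨ *-monoˡ-≤ n 1<m ⟩
  m * n      ≤⟨ mn≤m+n ⟩
  m + n      ∎)
  where open ≤-Reasoning

*≤+⇒≡4 : 1 < m → 1 < n → m * n ≤ m + n → m * n ≡ 4
*≤+⇒≡4 {m} {n} 1<m 1<n mn≤m+n
  with ≤-antisym (*≤+⇒≤ 1<m mn≤m+n) (*≤+⇒≤ 1<n (subst₂ _≤_ (*-comm m n) (+-comm m n) mn≤m+n))
... | refl = cong (λ k → k * k) (≤-antisym m≤2 1<m)
  where
  m≤2 : m ≤ 2
  m≤2 = *-cancelˡ-≤ m {{>-nonZero (<-trans (s≤s z≤n) 1<m)}}
    (subst (m * m ≤_) (trans (cong (_+_ m) (sym (+-identityʳ m))) (*-comm 2 m)) mn≤m+n)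

1≤product : ∀ {ns} → All (1 <_) ns → 1 ≤ product ns
1≤product []           = ≤-refl
1≤product (1<n ∷ 1<ns) = *-mono-≤ (<⇒≤ 1<n) (1≤product 1<ns)

1<product : ∀ {n ns} → All (1 <_) (n ∷ ns) → 1 < product (n ∷ ns)
1<product {n} {ns} (1<n ∷ 1<ns) = <-≤-trans 1<n (m≤m*n n (product ns) {{>-nonZero (1≤product 1<ns)}})

sum≤product : ∀ {ns} → All (1 <_) ns → sum ns ≤ product ns
sum≤product []                           = z≤n
sum≤product {n ∷ []} (_ ∷ [])            = ≤-reflexive (trans (+-identityʳ n) (sym (*-identityʳ n)))
sum≤product {n ∷ ns@(_ ∷ _)} (1<n ∷ 1<ns) = begin
  n + sum ns      ≤⟨ +-monoʳ-≤ n (sum≤product 1<ns) ⟩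
  n + product ns  ≤⟨ m+n≤m*n 1<n (1<product 1<ns) ⟩
  n * product ns  ∎
  where open ≤-Reasoning

B-product-fixed⇒≡4 : ∀ {ps} → All Prime ps → ¬ Prime (product ps) → B (product ps) ≡ product ps → product ps ≡ 4
B-product-fixed⇒≡4 []                 _      ()
B-product-fixed⇒≡4 {p ∷ []} (pp ∷ []) ¬prime _ = contradiction (subst Prime (sym (*-identityʳ p)) pp) ¬prime
B-product-fixed⇒≡4 {p ∷ ps@(_ ∷ _)} pps@(pp ∷ qs) _ B≡id =
  *≤+⇒≡4 (prime>1 pp) (1<product qs>1) (begin
    p * product ps      ≡⟨ B≡id ⟨
    B (p * product ps)  ≡⟨ B-product pps ⟩
    p + sum ps          ≤⟨ +-monoʳ-≤ p (sum≤product qs>1) ⟩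
    p + product ps      ∎)
  where
  open ≤-Reasoning
  qs>1 : All (1 <_) ps
  qs>1 = All.map prime>1 qs

B-fixed⇒≡4 : ∀ n → .{{NonZero n}} → ¬ Prime n → B n ≡ n → n ≡ 4
B-fixed⇒≡4 n = subst (λ m → ¬ Prime m → B m ≡ m → m ≡ 4) (sym isFactorisation) (B-product-fixed⇒≡4 factorsPrime)
  where open PrimeFactorisation (factorise n)

lemma3p1 : (a : ℤ) → a ≢ + 0 → (n : ℕ) → NonZero n →
    (Ba a n ≡ + n → n ≡ 4) × (n ≡ 4 → Ba a n ≡ + n)
lemma3p1 a a≢0 n nz = Ba≡id⇒≡4 , λ { refl → refl }
  where
  Ba≡id⇒≡4 : Ba a n ≡ + n → n ≡ 4
  Ba≡id⇒≡4 Ba≡n with prime? n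
  ... | yes _  = contradiction (identityʳ-unique (+ n) a Ba≡n) a≢0
  ... | no ¬pn = B-fixed⇒≡4 n {{nz}} ¬pn (+-injective Ba≡n)
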